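{- Let $S$ be a numerical semigroup with multiplicity $m$ and embedding dimension $\nu$. If $m-\nu\le 3$, then $S$ satisfies Wilf's Conjecture, i.e. $f+1\le \nu n$.
   Context: A numerical semigroup is a submonoid of $(\mathbb N,+)$ with finite complement. $f$ is its Frobenius number (largest integer not in $S$), $m$ its smallest nonzero element, $\nu$ its minimal number of generators, and $n=|\{s\in S: s<f\}|$. -}

module Defs where

open import Data.Nat using (ℕ; zero; suc; _+_; _≤_; _<_)
open import Data.Bool using (Bool; true; false)
open import Data.Product using (Σ; _×_; ∃)
open import Data.List using (List; length)
open import Data.List.Membership.Propositional using (_∈_)
open import Data.List.Relation.Unary.Unique.Propositional using (Unique)
open import Relation.Binary.PropositionalEquality using (_≡_)
open import Relation.Nullary using (¬_)
open import Function.Bundles using (_⇔_)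

record NumericalSemigroup : Set where
  field
    mem      : ℕ → Bool
    has-zero : mem 0 ≡ true
    closed   : ∀ a b → mem a ≡ true → mem b ≡ true → mem (a + b) ≡ true
    cofinite : ∃ λ c → ∀ x → c ≤ x → mem x ≡ true

open NumericalSemigroup public

_∈S_ : ℕ → NumericalSemigroup → Set
x ∈S S = mem S x ≡ true

-- f is the Frobenius number of S: the largest integer not in S
-- (this presupposes S ≠ ℕ).
IsFrobenius : NumericalSemigroup → ℕ → Set
IsFrobenius S f = ¬ (f ∈S S) × (∀ x → f < x → x ∈S S)

IsMultiplicity : NumericalSemigroup → ℕ → Set
IsMultiplicity S m = m ∈S S × ¬ (m ≡ 0) × (∀ s → s ∈S S → ¬ (s ≡ 0) → m ≤ s)

IsMinimalGenerator : NumericalSemigroup → ℕ → Set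
IsMinimalGenerator S x =
  x ∈S S × ¬ (x ≡ 0) ×
  ¬ (Σ ℕ λ a → Σ ℕ λ b → a ∈S S × b ∈S S × ¬ (a ≡ 0) × ¬ (b ≡ 0) × a + b ≡ x)

IsEmbeddingDimension : NumericalSemigroup → ℕ → Set
IsEmbeddingDimension S ν =
  Σ (List ℕ) λ gens → Unique gens × (∀ x → (x ∈ gens) ⇔ IsMinimalGenerator S x)
                    × length gens ≡ ν

countBelow : NumericalSemigroup → ℕ → ℕ
countBelow S zero = zero
countBelow S (suc k) with mem S k
... | true  = suc (countBelow S k)
... | false = countBelow S k

-- Put W = f + m. Every Apéry element u of S (u ∈ S, u − m ∉ S) is at most W, and the
-- q u = ⌊(W − u)/m⌋ (quotW u) elements u, u + m, …, u + (q u − 1)m of S lie below f; for distinct Apéry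
-- elements these progressions are disjoint. Hence n ≥ q 0 + Σ q u for distinct nonzero Apéry
-- elements u, and as f + 1 + e = m · q 0 with e = m − 1 − (W mod m) (slack), Wilf's inequality follows
-- from d · q 0 ≤ ν · Σ q u + e, where d = m − ν.
-- At least d of the m − 1 nonzero Apéry elements are not minimal generators, so they are sums of
-- two nonzero Apéry elements. For d ≤ 3 these summands yield Apéry elements u, v with u + v ≤ W,
-- and W ≤ (W − u) + (W − v) gives q 0 ≤ q u + q v + 1, where the + 1 forces the remainders of
-- W − u and W − v modulo m to be large, hence e to be large. This suffices when ν ≥ d; the one
-- remaining case ν = 2, m = 5 is S = ⟨5, g⟩, whose Apéry set is {0, g, 2g, 3g, 4g}.
module Submission where

open import Defs
open import Data.Bool using (true; false)
import Data.Bool as Bool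
open import Data.Empty using (⊥-elim)
import Data.Fin as Fin
open import Data.Fin.Properties using (injective⇒≤; toℕ-injective; toℕ<n)
open import Data.List using (List; []; _∷_; length; lookup; filter; _++_; map; upTo; tabulate)
open import Data.Nat.ListAction using (sum)
open import Data.List.Properties using (length-tabulate; length-++; length-map; length-upTo)
open import Data.List.Membership.Propositional using (_∈_; find)
open import Data.List.Membership.Propositional.Properties using (∈-lookup; ∈-tabulate⁻; ∈-map⁻; ∈-upTo⁻; ∈-++⁻; ∈-filter⁻)
open import Data.List.Relation.Binary.Subset.Propositional using (_⊆_)
import Data.List.Relation.Unary.All as All
open import Data.List.Relation.Unary.All using (All)
open import Data.List.Relation.Unary.AllPairs using ([]; _∷_)
open import Data.List.Relation.Unary.Any using (Any; here; there; index; any?)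
open import Data.List.Relation.Unary.All.Properties using (¬Any⇒All¬)
open import Data.List.Relation.Unary.Any.Properties using (lookup-index)
open import Data.List.Relation.Unary.Unique.Propositional using (Unique)
open import Data.List.Relation.Unary.Unique.Propositional.Properties using (tabulate⁺; map⁺; upTo⁺; ++⁺; filter⁺)
open import Data.Nat using (ℕ; zero; suc; _+_; _*_; _∸_; _≤_; _<_; z≤n; s≤s; z<s; _≟_; _≤?_; NonZero; ≢-nonZero)
open import Data.Nat.DivMod using (_/_; _%_; m<n⇒m%n≡m; [m+kn]%n≡m%n; m≡m%n+[m/n]*n; m%n<n; m/n*n≤m; m≥n⇒m/n>0)
open import Data.Nat.Properties
open import Data.Nat.Induction using (<-rec)
open import Data.Nat.Tactic.RingSolver using (solve)
open import Data.Product using (Σ; ∃; _×_; _,_; proj₁; proj₂)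
open import Data.Sum using (_⊎_; inj₁; inj₂; [_,_]′)
open import Relation.Binary using (tri<; tri≈; tri>)
open import Relation.Binary.PropositionalEquality
open import Relation.Nullary using (¬_; Dec; does; yes; no; ¬?; _×-dec_)
import Relation.Nullary.Decidable as Dec
open import Function using (case_of_; _∘_)
open import Function.Bundles using (Equivalence)
open import Relation.Unary using (Pred; Decidable)
open import Relation.Unary.Properties using (∁?)

module _ {A : Set} where

  lookup-injective : ∀ {xs : List A} → Unique xs → ∀ {i j} → lookup xs i ≡ lookup xs j → i ≡ j
  lookup-injective (_ ∷ _)  {Fin.zero}  {Fin.zero}  _ = refl
  lookup-injective (x∉ ∷ _) {Fin.zero}  {Fin.suc j} e = ⊥-elim (All.lookup x∉ (∈-lookup j) e)
  lookup-injective (x∉ ∷ _) {Fin.suc i} {Fin.zero}  e = ⊥-elim (All.lookup x∉ (∈-lookup i) (sym e))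
  lookup-injective (_ ∷ u)  {Fin.suc i} {Fin.suc j} e = cong Fin.suc (lookup-injective u e)

  unique-⊆⇒length≤ : ∀ {xs ys : List A} → Unique xs → xs ⊆ ys → length xs ≤ length ys
  unique-⊆⇒length≤ {xs} {ys} u xs⊆ys = injective⇒≤ position-injective
    where
    position : Fin.Fin (length xs) → Fin.Fin (length ys)
    position i = index (xs⊆ys (∈-lookup i))

    position-injective : ∀ {i j} → position i ≡ position j → i ≡ j
    position-injective {i} {j} e = lookup-injective u (begin
      lookup xs i             ≡⟨ lookup-index (xs⊆ys (∈-lookup i)) ⟩
      lookup ys (position i)  ≡⟨ cong (lookup ys) e ⟩
      lookup ys (position j)  ≡⟨ lookup-index (xs⊆ys (∈-lookup j)) ⟨
      lookup xs j             ∎)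
      where open ≡-Reasoning

  length-filter+length-filter-∁ : ∀ {p} {P : Pred A p} (P? : Decidable P) xs →
    length (filter P? xs) + length (filter (∁? P?) xs) ≡ length xs
  length-filter+length-filter-∁ P? [] = refl
  length-filter+length-filter-∁ P? (x ∷ xs) with does (P? x)
  ... | true  = cong suc (length-filter+length-filter-∁ P? xs)
  ... | false = trans (+-suc _ _) (cong suc (length-filter+length-filter-∁ P? xs))

  nonempty⇒∈ : ∀ {xs : List A} → 1 ≤ length xs → ∃ λ x → x ∈ xs
  nonempty⇒∈ {x ∷ _} _ = x , here refl

  two-distinct : ∀ {xs : List A} → Unique xs → 2 ≤ length xs → ∃ λ x → ∃ λ y → x ∈ xs × y ∈ xs × x ≢ y
  two-distinct {x ∷ y ∷ _} ((x≢y All.∷ _) ∷ _) _ = x , y , here refl , there (here refl) , x≢y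
  two-distinct {_ ∷ []} _ (s≤s ())

  three-distinct : ∀ {xs : List A} → Unique xs → 3 ≤ length xs →
                   ∃ λ x → ∃ λ y → ∃ λ z → x ∈ xs × y ∈ xs × z ∈ xs × x ≢ y × x ≢ z × y ≢ z
  three-distinct {x ∷ y ∷ z ∷ _} ((x≢y All.∷ x≢z All.∷ _) ∷ (y≢z All.∷ _) ∷ _) _ =
    x , y , z , here refl , there (here refl) , there (there (here refl)) , x≢y , x≢z , y≢z
  three-distinct {_ ∷ []}     _ (s≤s ())
  three-distinct {_ ∷ _ ∷ []} _ (s≤s (s≤s ()))

sum-three : ∀ a b c → sum (a ∷ b ∷ c ∷ []) ≡ a + b + c
sum-three a b c = trans (cong (λ n → a + (b + n)) (+-identityʳ c)) (sym (+-assoc a b c))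

module _ (S : NumericalSemigroup) where

  elementsBelow : ℕ → List ℕ
  elementsBelow zero = []
  elementsBelow (suc k) with mem S k
  ... | true  = k ∷ elementsBelow k
  ... | false = elementsBelow k

  length-elementsBelow : ∀ k → length (elementsBelow k) ≡ countBelow S k
  length-elementsBelow zero = refl
  length-elementsBelow (suc k) with mem S k
  ... | true  = cong suc (length-elementsBelow k)
  ... | false = length-elementsBelow k

  ∈-elementsBelow : ∀ {k x} → x < k → x ∈S S → x ∈ elementsBelow k
  ∈-elementsBelow {suc k} {x} x<1+k x∈S with x ≟ k | mem S k in mem-k
  ... | yes refl | true  = here refl
  ... | yes refl | false = case trans (sym x∈S) mem-k of λ ()
  ... | no x≢k   | true  = there (∈-elementsBelow (≤∧≢⇒< (≤-pred x<1+k) x≢k) x∈S)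
  ... | no x≢k   | false = ∈-elementsBelow (≤∧≢⇒< (≤-pred x<1+k) x≢k) x∈S

  unique-below⇒≤countBelow : ∀ {k xs} → Unique xs → (∀ {x} → x ∈ xs → x < k × x ∈S S) →
                             length xs ≤ countBelow S k
  unique-below⇒≤countBelow {k} {xs} u below = begin
    length xs                 ≤⟨ unique-⊆⇒length≤ u (λ x∈xs → let x<k , x∈S = below x∈xs
                                                         in ∈-elementsBelow x<k x∈S) ⟩
    length (elementsBelow k)  ≡⟨ length-elementsBelow k ⟩
    countBelow S k            ∎
    where open ≤-Reasoning

doubles⇒sum-≤ : ∀ {a b n} → a + a ≤ n → b + b ≤ n → a + b ≤ n
doubles⇒sum-≤ {a} {b} a+a≤n b+b≤n with ≤-total a b
... | inj₁ a≤b = ≤-trans (+-monoˡ-≤ b a≤b) b+b≤n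
... | inj₂ b≤a = ≤-trans (+-monoʳ-≤ a b≤a) a+a≤n

quotient-tight : ∀ {m K N r σ} → σ < m + m → K * m + r ≤ N * m + σ →
                 K ≤ N ⊎ (K ≡ suc N × m + r ≤ σ)
quotient-tight {m} {K} {N} {r} {σ} σ<2m Km+r≤ with K ≤? N
... | yes K≤N = inj₁ K≤N
... | no  K≰N = inj₂ (≤-antisym K≤1+N N<K , subst (_≤ σ) (cong (_+ r) (*-identityˡ m)) (excess 1 N<K))
  where
  N<K : suc N ≤ K
  N<K = ≰⇒> K≰N

  excess : ∀ k → k + N ≤ K → k * m + r ≤ σ
  excess k k+N≤K = +-cancelˡ-≤ (N * m) _ _ (begin
    N * m + (k * m + r)  ≡⟨ solve (N ∷ k ∷ m ∷ r ∷ []) ⟩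
    (k + N) * m + r      ≤⟨ +-monoˡ-≤ r (*-monoˡ-≤ m k+N≤K) ⟩
    K * m + r            ≤⟨ Km+r≤ ⟩
    N * m + σ            ∎)
    where open ≤-Reasoning

  K≤1+N : K ≤ suc N
  K≤1+N = ≮⇒≥ λ 1+N<K → <⇒≱ σ<2m (begin
    m + m            ≡⟨ solve (m ∷ []) ⟩
    2 * m            ≤⟨ m≤m+n (2 * m) r ⟩
    2 * m + r        ≤⟨ excess 2 1+N<K ⟩
    σ                ∎)
    where open ≤-Reasoning

quotient-bound : ∀ {m K N r σ} → σ < m + m → K * m + r ≤ N * m + σ → K ≤ suc N
quotient-bound σ<2m Km+r≤ with quotient-tight σ<2m Km+r≤
... | inj₁ K≤N        = m≤n⇒m≤1+n K≤N
... | inj₂ (refl , _) = ≤-refl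

slack-from-tight : ∀ {m r σ} c → m + r ≤ σ → c + σ < m + m → c ≤ m ∸ suc r
slack-from-tight {m} {r} {σ} c m+r≤σ c+σ<2m =
  subst (_≤ m ∸ suc r) (m+n∸m≡n (suc r) c) (∸-monoˡ-≤ (suc r) (+-cancelˡ-≤ m _ _ (begin
    m + (suc r + c)  ≡⟨ solve (m ∷ r ∷ c ∷ []) ⟩
    suc (c + (m + r)) ≤⟨ s≤s (+-monoʳ-≤ c m+r≤σ) ⟩
    suc (c + σ)      ≤⟨ c+σ<2m ⟩
    m + m            ∎)))
  where open ≤-Reasoning

scaled-quotient-bound : ∀ {m K N r σ} c → c + σ < m + m → K * m + r ≤ N * m + σ →
                        c * K ≤ c * N + (m ∸ suc r)
scaled-quotient-bound {m} {K} {N} {r} {σ} c c+σ<2m Km+r≤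
  with quotient-tight (≤-trans (s≤s (m≤n+m σ c)) c+σ<2m) Km+r≤
... | inj₁ K≤N = ≤-trans (*-monoʳ-≤ c K≤N) (m≤m+n (c * N) _)
... | inj₂ (refl , m+r≤σ) = begin
  c * suc N              ≡⟨ solve (c ∷ N ∷ []) ⟩
  c * N + c              ≤⟨ +-monoʳ-≤ (c * N) (slack-from-tight {m} {r} c m+r≤σ c+σ<2m) ⟩
  c * N + (m ∸ suc r)    ∎
  where open ≤-Reasoning

1+sum<double : ∀ {m a b} → a < m → b < m → suc (a + b) < m + m
1+sum<double {m} {a} {b} a<m b<m = ≤-trans (s≤s (≤-reflexive (sym (+-suc a b)))) (+-mono-≤ a<m b<m)

2+sum<double : ∀ {m a b} → a < m → b < m → a ≢ b → 2 + (a + b) < m + m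
2+sum<double {m} {a} {b} a<m b<m a≢b with <-cmp a b
... | tri< a<b _ _ = 1+sum<double {m} (≤-trans (s≤s a<b) b<m) b<m
... | tri≈ _ a≡b _ = ⊥-elim (a≢b a≡b)
... | tri> _ _ b<a = subst (_< m + m) (cong suc (+-suc a b)) (1+sum<double {m} a<m (≤-trans (s≤s b<a) a<m))

private
  -- If the pair (a, b) is tight then a ≤ b, and since s < m − 1 the pair (a, a) leaves room for 3.
  double-pair-bound-< : ∀ {m K r a b s t} → s < t → t < m →
    K * m + r ≤ (a + a) * m + (s + s) → K * m + r ≤ (b + b) * m + (t + t) →
    K * m + r ≤ (a + b) * m + (s + t) → 3 * K ≤ 3 * (a + b) + (m ∸ suc r)
  double-pair-bound-< {m} {K} {r} {a} {b} {s} {t} s<t t<m Kaa Kbb Kab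
    with quotient-tight {m} {K} {a + b} {r} (+-mono-< (<-trans s<t t<m) t<m) Kab
  ... | inj₁ K≤a+b = ≤-trans (*-monoʳ-≤ 3 K≤a+b) (m≤m+n _ _)
  ... | inj₂ (refl , _) = begin
    3 * K                        ≤⟨ scaled-quotient-bound {m} {N = a + a} {r} 3 3+2s<2m Kaa ⟩
    3 * (a + a) + (m ∸ suc r)    ≤⟨ +-monoˡ-≤ (m ∸ suc r) (*-monoʳ-≤ 3 (+-monoʳ-≤ a a≤b)) ⟩
    3 * (a + b) + (m ∸ suc r)    ∎
    where
    open ≤-Reasoning
    a≤b : a ≤ b
    a≤b = +-cancelʳ-≤ b a b (≤-pred (quotient-bound (+-mono-< t<m t<m) Kbb))
    1+s<m : suc s < m
    1+s<m = ≤-trans (s≤s s<t) t<m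
    3+2s<2m : 3 + (s + s) < m + m
    3+2s<2m = subst (_< m + m) (cong (suc ∘ suc) (+-suc s s)) (1+sum<double {m} 1+s<m 1+s<m)

double-pair-bound : ∀ {m K r a b s t} → s < m → t < m → s ≢ t →
  K * m + r ≤ (a + a) * m + (s + s) → K * m + r ≤ (b + b) * m + (t + t) →
  K * m + r ≤ (a + b) * m + (s + t) → 3 * K ≤ 3 * (a + b) + (m ∸ suc r)
double-pair-bound {m} {K} {r} {a} {b} {s} {t} s<m t<m s≢t Kaa Kbb Kab with <-cmp s t
... | tri< s<t _ _ = double-pair-bound-< {m} {K} {r} {a} {b} s<t t<m Kaa Kbb Kab
... | tri≈ _ s≡t _ = ⊥-elim (s≢t s≡t)
... | tri> _ _ t<s = subst (λ n → 3 * K ≤ 3 * n + (m ∸ suc r)) (+-comm b a)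
  (double-pair-bound-< {m} {K} {r} {b} {a} t<s s<m Kbb Kaa
    (subst₂ (λ N σ → K * m + r ≤ N * m + σ) (+-comm a b) (+-comm s t) Kab))

star-bound : ∀ {m K N r σ c} → σ < m + m → K * m + r ≤ N * m + σ → 1 ≤ c → K ≤ N + c
star-bound {N = N} {c = c} σ<2m Km+r≤ 1≤c =
  ≤-trans (quotient-bound σ<2m Km+r≤) (subst (_≤ N + c) (+-comm N 1) (+-monoʳ-≤ N 1≤c))

private
  combine-bounds : ∀ {K P Q α β E} → K ≤ P + α → K ≤ Q + β → α + 2 * β ≤ E → 3 * K ≤ P + 2 * Q + E
  combine-bounds {K} {P} {Q} {α} {β} {E} K≤P+α K≤Q+β α+2β≤E = begin
    3 * K                      ≡⟨ solve (K ∷ []) ⟩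
    K + 2 * K                  ≤⟨ +-mono-≤ K≤P+α (*-monoʳ-≤ 2 K≤Q+β) ⟩
    P + α + 2 * (Q + β)        ≡⟨ solve (P ∷ α ∷ Q ∷ β ∷ []) ⟩
    P + 2 * Q + (α + 2 * β)    ≤⟨ +-monoʳ-≤ (P + 2 * Q) α+2β≤E ⟩
    P + 2 * Q + E              ∎
    where open ≤-Reasoning

  tight⇒≤+1 : ∀ {K P} → K ≡ suc P → K ≤ P + 1
  tight⇒≤+1 K≡1+P = ≤-reflexive (trans K≡1+P (+-comm 1 _))

  ≤⇒≤+0 : ∀ {K P} → K ≤ P → K ≤ P + 0
  ≤⇒≤+0 = subst (_ ≤_) (sym (+-identityʳ _))

five-bound : ∀ {m K r a b c s₁ s₂ s₃} → m ≡ 5 →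
  s₁ < m → s₂ < m → s₃ < m → s₁ ≢ s₂ → s₁ ≢ s₃ → s₂ ≢ s₃ →
  K * m + r ≤ (b + b) * m + (s₂ + s₂) → K * m + r ≤ (a + c) * m + (s₁ + s₃) →
  3 * K ≤ 2 * (a + b + c) + (m ∸ suc r)
five-bound {K = K} {r} {a} {b} {c} {s₁} {s₂} {s₃} refl s₁<5 s₂<5 s₃<5 s₁≢s₂ s₁≢s₃ s₂≢s₃ Kbb Kac =
  begin
    3 * K                        ≤⟨ by-tightness (quotient-tight (+-mono-< s₂<5 s₂<5) Kbb)
                                                 (quotient-tight (+-mono-< s₁<5 s₃<5) Kac) ⟩
    (b + b) + 2 * (a + c) + E    ≡⟨ cong (_+ E) (solve (a ∷ b ∷ c ∷ [])) ⟩
    2 * (a + b + c) + E          ∎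
  where
  open ≤-Reasoning
  E = 5 ∸ suc r
  by-tightness : K ≤ b + b ⊎ (K ≡ suc (b + b) × 5 + r ≤ s₂ + s₂) →
                 K ≤ a + c ⊎ (K ≡ suc (a + c) × 5 + r ≤ s₁ + s₃) →
                 3 * K ≤ (b + b) + 2 * (a + c) + E
  by-tightness (inj₁ K≤2b) (inj₁ K≤a+c) =
    combine-bounds {α = 0} {β = 0} (≤⇒≤+0 K≤2b) (≤⇒≤+0 K≤a+c) z≤n
  by-tightness (inj₂ (K≡ , tb)) (inj₁ K≤a+c) =
    combine-bounds {α = 1} {β = 0} (tight⇒≤+1 K≡) (≤⇒≤+0 K≤a+c)
      (slack-from-tight {5} {r} 1 tb (1+sum<double s₂<5 s₂<5))
  by-tightness (inj₁ K≤2b) (inj₂ (K≡ , tac)) =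
    combine-bounds {α = 0} {β = 1} (≤⇒≤+0 K≤2b) (tight⇒≤+1 K≡)
      (slack-from-tight {5} {r} 2 tac (2+sum<double s₁<5 s₃<5 s₁≢s₃))
  by-tightness (inj₂ (K≡ , tb)) (inj₂ (K≡′ , tac)) =
    combine-bounds {α = 1} {β = 1} (tight⇒≤+1 K≡) (tight⇒≤+1 K≡′) three≤slack
    where
    three≤slack : 3 ≤ E
    three≤slack with s₂ ≟ 4
    ... | yes refl = slack-from-tight {5} {r} 3 tac (≤-trans (s≤s (2+sum<double {4}
                       (≤∧≢⇒< (≤-pred s₁<5) s₁≢s₂) (≤∧≢⇒< (≤-pred s₃<5) (s₂≢s₃ ∘ sym)) s₁≢s₃)) (n≤1+n 9))
    ... | no s₂≢4  = slack-from-tight {5} {r} 3 tb (s≤s (s≤s (1+sum<double {4} s₂<4 s₂<4)))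
      where
      s₂<4 : s₂ < 4
      s₂<4 = ≤∧≢⇒< (≤-pred s₂<5) s₂≢4

private
  frobenius-slack : ∀ {f m K r} → r < m → f + m ≡ K * m + r → f + 1 + (m ∸ suc r) ≡ K * m
  frobenius-slack {f} {m} {K} {r} r<m f+m≡ = +-cancelʳ-≡ r _ _ (begin
    f + 1 + (m ∸ suc r) + r      ≡⟨ regroup (m ∸ suc r) ⟩
    f + ((m ∸ suc r) + suc r)    ≡⟨ cong (f +_) (m∸n+n≡m r<m) ⟩
    f + m                        ≡⟨ f+m≡ ⟩
    K * m + r                    ∎)
    where
    open ≡-Reasoning
    regroup : ∀ e → f + 1 + e + r ≡ f + (e + suc r)
    regroup e = solve (f ∷ e ∷ r ∷ [])

  wilf-arithmetic-with-slack : ∀ {f m ν d K N E} → f + 1 + E ≡ K * m → m ≤ ν + d →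
                               d * K ≤ ν * N + E → f + 1 ≤ ν * (K + N)
  wilf-arithmetic-with-slack {f} {m} {ν} {d} {K} {N} {E} f+1+E≡ m≤ν+d dK≤ = +-cancelʳ-≤ E (f + 1) _ (begin
    f + 1 + E           ≡⟨ f+1+E≡ ⟩
    K * m               ≤⟨ *-monoʳ-≤ K m≤ν+d ⟩
    K * (ν + d)         ≡⟨ solve (K ∷ ν ∷ d ∷ []) ⟩
    ν * K + d * K       ≤⟨ +-monoʳ-≤ (ν * K) dK≤ ⟩
    ν * K + (ν * N + E) ≡⟨ solve (ν ∷ K ∷ N ∷ E ∷ []) ⟩
    ν * (K + N) + E     ∎)
    where open ≤-Reasoning

wilf-arithmetic : ∀ {f m ν d K r N} → r < m → f + m ≡ K * m + r → m ≤ ν + d →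
                  d * K ≤ ν * N + (m ∸ suc r) → f + 1 ≤ ν * (K + N)
wilf-arithmetic {f} {m} {ν} {d} {K} {r} {N} r<m f+m≡ =
  wilf-arithmetic-with-slack {f} {m} {ν} {d} {K} {N} (frobenius-slack {f} {m} {K} {r} r<m f+m≡)

1+n∸2≡3⇒n≡4 : ∀ n → suc n ∸ 2 ≡ 3 → n ≡ 4
1+n∸2≡3⇒n≡4 (suc n) refl = refl

remainder-injective : ∀ {n i i′} j j′ .{{_ : NonZero n}} → i < n → i′ < n →
                      i + j * n ≡ i′ + j′ * n → i ≡ i′
remainder-injective {n} {i} {i′} j j′ i<n i′<n eq = begin
  i                  ≡⟨ m<n⇒m%n≡m i<n ⟨
  i % n              ≡⟨ [m+kn]%n≡m%n i j n ⟨
  (i + j * n) % n    ≡⟨ cong (_% n) eq ⟩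
  (i′ + j′ * n) % n  ≡⟨ [m+kn]%n≡m%n i′ j′ n ⟩
  i′ % n             ≡⟨ m<n⇒m%n≡m i′<n ⟩
  i′                 ∎
  where open ≡-Reasoning

Decomposable : NumericalSemigroup → ℕ → Set
Decomposable S x = Σ ℕ λ a → Σ ℕ λ b → a ∈S S × b ∈S S × a ≢ 0 × b ≢ 0 × a + b ≡ x

module Apery (S : NumericalSemigroup) (m′ : ℕ) (multiplicity : IsMultiplicity S (suc m′)) where

  m : ℕ
  m = suc m′

  ∈S? : ∀ x → Dec (x ∈S S)
  ∈S? x = mem S x Bool.≟ true

  ∈S-+ : ∀ {a b} → a ∈S S → b ∈S S → (a + b) ∈S S
  ∈S-+ = closed S _ _

  multiple-∈S : ∀ {g} → g ∈S S → ∀ k → (k * g) ∈S S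
  multiple-∈S g∈S zero    = has-zero S
  multiple-∈S g∈S (suc k) = ∈S-+ g∈S (multiple-∈S g∈S k)

  multiplicity-≤ : ∀ {x} → x ∈S S → x ≢ 0 → m ≤ x
  multiplicity-≤ = proj₂ (proj₂ multiplicity) _

  IsApery : ℕ → Set
  IsApery x = x ∈S S × (∀ y → y ∈S S → y + m ≢ x)

  NonzeroApery : ℕ → Set
  NonzeroApery x = IsApery x × x ≢ 0

  zero-apery : IsApery 0
  zero-apery = has-zero S , λ y _ y+m≡0 → 1+n≢0 (trans (sym (+-suc y m′)) y+m≡0)

  ¬multiplicity-apery : ¬ IsApery m
  ¬multiplicity-apery (_ , m-apery) = m-apery 0 (has-zero S) refl

  apery-summand : ∀ {x a b} → IsApery x → a ∈S S → b ∈S S → a + b ≡ x → IsApery a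
  apery-summand {b = b} (_ , x-apery) a∈S b∈S a+b≡x = a∈S , λ y y∈S y+m≡a →
    x-apery (y + b) (∈S-+ y∈S b∈S) (trans (swap y m) (trans (cong (_+ b) y+m≡a) a+b≡x))
    where
    swap : ∀ y n → y + b + n ≡ y + n + b
    swap y n = solve (y ∷ b ∷ n ∷ [])

  private
    apery-lift : ∀ {x y i j} → IsApery x → y ∈S S → i < j → x + i * m ≢ y + j * m
    apery-lift {x} {y} {i} (_ , x-apery) y∈S i<j eq with m≤n⇒∃[o]m+o≡n i<j
    ... | k , refl = x-apery (y + k * m) (∈S-+ y∈S (multiple-∈S (proj₁ multiplicity) k))
                       (+-cancelʳ-≡ (i * m) _ _ (begin
      y + k * m + m + i * m    ≡⟨ regroup m ⟩
      y + (suc i + k) * m      ≡⟨ eq ⟨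
      x + i * m                ∎))
      where
      open ≡-Reasoning
      regroup : ∀ n → y + k * n + n + i * n ≡ y + (suc i + k) * n
      regroup n = solve (y ∷ k ∷ n ∷ i ∷ [])

  apery-cancel : ∀ {x y i j} → IsApery x → IsApery y → x + i * m ≡ y + j * m → x ≡ y
  apery-cancel {x} {y} {i} {j} x-apery y-apery eq with <-cmp i j
  ... | tri< i<j _ _ = ⊥-elim (apery-lift x-apery (proj₁ y-apery) i<j eq)
  ... | tri≈ _ refl _ = +-cancelʳ-≡ (i * m) x y eq
  ... | tri> _ _ j<i = ⊥-elim (apery-lift y-apery (proj₁ x-apery) j<i (sym eq))

  decomposable? : ∀ x → Dec (Decomposable S x)
  decomposable? x = Dec.map′ witness bounded (anyUpTo? summands? x)
    where
    Summands : ℕ → Set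
    Summands a = a ∈S S × (x ∸ a) ∈S S × a ≢ 0 × x ∸ a ≢ 0

    summands? : ∀ a → Dec (Summands a)
    summands? a = ∈S? a ×-dec ∈S? (x ∸ a) ×-dec ¬? (a ≟ 0) ×-dec ¬? ((x ∸ a) ≟ 0)

    witness : ∃ (λ a → a < x × Summands a) → Decomposable S x
    witness (a , a<x , a∈S , b∈S , a≢0 , b≢0) = a , x ∸ a , a∈S , b∈S , a≢0 , b≢0 , m+[n∸m]≡n (<⇒≤ a<x)

    bounded : Decomposable S x → ∃ (λ a → a < x × Summands a)
    bounded (a , b , a∈S , b∈S , a≢0 , b≢0 , refl) =
      a , m<m+n a (n≢0⇒n>0 b≢0) , a∈S , b∈S′ , a≢0 , b≢0 ∘ trans (sym (m+n∸m≡n a b))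
      where
      b∈S′ : (a + b ∸ a) ∈S S
      b∈S′ = subst (_∈S S) (sym (m+n∸m≡n a b)) b∈S

  multiplicity-minimal : IsMinimalGenerator S m
  multiplicity-minimal = proj₁ multiplicity , (λ ()) , λ (a , b , a∈S , b∈S , a≢0 , b≢0 , a+b≡m) →
    <⇒≢ (subst (_< a + b) (+-identityʳ m) (+-mono-≤-< (multiplicity-≤ a∈S a≢0) (n≢0⇒n>0 b≢0))) (sym a+b≡m)

  record Split (x : ℕ) : Set where
    constructor split
    field
      a b     : ℕ
      a-apery : NonzeroApery a
      b-apery : NonzeroApery b
      a+b≡x   : a + b ≡ x

  apery-split : ∀ {x} → IsApery x → Decomposable S x → Split x
  apery-split x-apery (a , b , a∈S , b∈S , a≢0 , b≢0 , a+b≡x) =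
    split a b (apery-summand x-apery a∈S b∈S a+b≡x , a≢0)
              (apery-summand x-apery b∈S a∈S (trans (+-comm b a) a+b≡x) , b≢0) a+b≡x

  ∃-indecomposable-apery : ∀ x → NonzeroApery x → ∃ λ g → NonzeroApery g × ¬ Decomposable S g
  ∃-indecomposable-apery = <-rec _ step
    where
    step : ∀ x → (∀ {y} → y < x → NonzeroApery y → ∃ λ g → NonzeroApery g × ¬ Decomposable S g) →
           NonzeroApery x → ∃ λ g → NonzeroApery g × ¬ Decomposable S g
    step x below x-apery with decomposable? x
    ... | no ¬dec = x , x-apery , ¬dec
    ... | yes dec with apery-split (proj₁ x-apery) dec
    ...   | split a b a-apery (_ , b≢0) refl = below (m<m+n a (n≢0⇒n>0 b≢0)) a-apery

  -- Scanning down from i + k m, the last element before leaving S is the least element of S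
  -- congruent to i.
  descend : ℕ → ℕ → ℕ
  descend i zero    = i
  descend i (suc k) with mem S (i + k * m)
  ... | true  = descend i k
  ... | false = i + suc k * m

  descend-apery : ∀ i k → ¬ (i ∈S S) → (i + k * m) ∈S S →
                  IsApery (descend i k) × ∃ λ j → descend i k ≡ i + j * m
  descend-apery i zero    i∉S i∈S = ⊥-elim (i∉S (subst (_∈S S) (+-identityʳ i) i∈S))
  descend-apery i (suc k) i∉S top∈S with mem S (i + k * m) in below∈S
  ... | true  = descend-apery i k i∉S below∈S
  ... | false = (top∈S , λ y y∈S y+m≡top → case trans (sym (subst (_∈S S) (below y+m≡top) y∈S)) below∈S of λ ())
              , suc k , refl
    where
    below : ∀ {y} → y + m ≡ i + suc k * m → y ≡ i + k * m
    below {y} y+m≡top = +-cancelʳ-≡ m y _ (trans y+m≡top (regroup m))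
      where
      regroup : ∀ n → i + suc k * n ≡ i + k * n + n
      regroup n = solve (i ∷ k ∷ n ∷ [])

  aperyElement : ℕ → ℕ
  aperyElement i = descend i (proj₁ (cofinite S))

  aperyElement-apery : ∀ {i} → 0 < i → i < m → IsApery (aperyElement i) × ∃ λ j → aperyElement i ≡ i + j * m
  aperyElement-apery {i} 0<i i<m = descend-apery i c i∉S (proj₂ (cofinite S) _ c≤)
    where
    c = proj₁ (cofinite S)
    i∉S : ¬ (i ∈S S)
    i∉S i∈S = <⇒≱ i<m (multiplicity-≤ i∈S (≢-sym (<⇒≢ 0<i)))
    c≤ : c ≤ i + c * m
    c≤ = ≤-trans (m≤m*n c m) (m≤n+m (c * m) i)

  nonzeroAperyElements : List ℕ
  nonzeroAperyElements = tabulate (λ (i : Fin.Fin m′) → aperyElement (suc (Fin.toℕ i)))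

  nonzeroAperyElements-apery : ∀ {w} → w ∈ nonzeroAperyElements → NonzeroApery w
  nonzeroAperyElements-apery w∈ with ∈-tabulate⁻ w∈
  ... | i , refl with aperyElement-apery z<s (s≤s (toℕ<n i))
  ...   | w-apery , j , w≡ = w-apery , λ w≡0 → 1+n≢0 (trans (sym w≡) w≡0)

  nonzeroAperyElements-unique : Unique nonzeroAperyElements
  nonzeroAperyElements-unique = tabulate⁺ λ {i} {i′} eq →
    let _ , j , w≡ = aperyElement-apery z<s (s≤s (toℕ<n i))
        _ , j′ , w′≡ = aperyElement-apery z<s (s≤s (toℕ<n i′))
    in toℕ-injective (suc-injective (remainder-injective j j′ (s≤s (toℕ<n i)) (s≤s (toℕ<n i′))
         (trans (sym w≡) (trans eq w′≡))))

  length-nonzeroAperyElements : length nonzeroAperyElements ≡ m′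
  length-nonzeroAperyElements = length-tabulate _

  module Generators (ν : ℕ) (embedding : IsEmbeddingDimension S ν) where

    minimal-generators-≤ν : ∀ {xs} → Unique xs → (∀ {x} → x ∈ xs → IsMinimalGenerator S x) →
                            length xs ≤ ν
    minimal-generators-≤ν {xs} xs-unique xs-minimal =
      let _ , _ , gens⇔ , length≡ν = embedding
      in subst (length xs ≤_) length≡ν
           (unique-⊆⇒length≤ xs-unique λ x∈xs → Equivalence.from (gens⇔ _) (xs-minimal x∈xs))

    indecomposable-minimal : ∀ {x} → NonzeroApery x → ¬ Decomposable S x → IsMinimalGenerator S x
    indecomposable-minimal ((x∈S , _) , x≢0) ¬dec = x∈S , x≢0 , ¬dec

    multiplicity≢apery : ∀ {x} → NonzeroApery x → m ≢ x
    multiplicity≢apery (x-apery , _) refl = ¬multiplicity-apery x-apery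

    2≤ν : ∀ {x} → NonzeroApery x → 2 ≤ ν
    2≤ν {x} x-apery with ∃-indecomposable-apery x x-apery
    ... | g , g-apery , g-indecomposable =
      minimal-generators-≤ν ((multiplicity≢apery g-apery All.∷ All.[]) ∷ All.[] ∷ [])
        λ { (here refl)         → multiplicity-minimal
          ; (there (here refl)) → indecomposable-minimal g-apery g-indecomposable }

    decomposables indecomposables : List ℕ
    decomposables   = filter decomposable? nonzeroAperyElements
    indecomposables = filter (∁? decomposable?) nonzeroAperyElements

    decomposables-unique : Unique decomposables
    decomposables-unique = filter⁺ decomposable? nonzeroAperyElements-unique

    ∈-decomposables⁻ : ∀ {x} → x ∈ decomposables → NonzeroApery x × Decomposable S x
    ∈-decomposables⁻ x∈ =
      let x∈all , dec = ∈-filter⁻ decomposable? x∈ in nonzeroAperyElements-apery x∈all , dec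

    ∈-indecomposables⁻ : ∀ {x} → x ∈ indecomposables → NonzeroApery x × ¬ Decomposable S x
    ∈-indecomposables⁻ x∈ =
      let x∈all , ¬dec = ∈-filter⁻ (∁? decomposable?) x∈ in nonzeroAperyElements-apery x∈all , ¬dec

    many-decomposables : m ∸ ν ≤ length decomposables
    many-decomposables = begin
      m ∸ ν                                  ≤⟨ ∸-monoʳ-≤ m indecomposables+1≤ν ⟩
      m′ ∸ length indecomposables            ≡⟨ cong (_∸ length indecomposables) partition ⟨
      length decomposables + length indecomposables ∸ length indecomposables
                                             ≡⟨ m+n∸n≡m (length decomposables) (length indecomposables) ⟩
      length decomposables                   ∎
      where
      open ≤-Reasoning
      partition : length decomposables + length indecomposables ≡ m′
      partition = trans (length-filter+length-filter-∁ decomposable? nonzeroAperyElements) length-nonzeroAperyElements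
      indecomposables+1≤ν : suc (length indecomposables) ≤ ν
      indecomposables+1≤ν = minimal-generators-≤ν
        (All.tabulate (multiplicity≢apery ∘ proj₁ ∘ ∈-indecomposables⁻)
          ∷ filter⁺ (∁? decomposable?) nonzeroAperyElements-unique)
        λ { (here refl) → multiplicity-minimal
          ; (there w∈)  → let w-apery , ¬dec = ∈-indecomposables⁻ w∈ in indecomposable-minimal w-apery ¬dec }

    indecomposables-equal : ν ≡ 2 → ∀ {x y} → NonzeroApery x → ¬ Decomposable S x →
                            NonzeroApery y → ¬ Decomposable S y → x ≡ y
    indecomposables-equal ν≡2 {x} {y} x-apery x-indecomposable y-apery y-indecomposable with x ≟ y
    ... | yes x≡y = x≡y
    ... | no  x≢y = ⊥-elim (<-irrefl refl (subst (3 ≤_) ν≡2 (minimal-generators-≤ν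
          ((multiplicity≢apery x-apery All.∷ multiplicity≢apery y-apery All.∷ All.[])
            ∷ (x≢y All.∷ All.[]) ∷ All.[] ∷ [])
          λ { (here refl)                 → multiplicity-minimal
            ; (there (here refl))         → indecomposable-minimal x-apery x-indecomposable
            ; (there (there (here refl))) → indecomposable-minimal y-apery y-indecomposable })))

    apery-multiple : ν ≡ 2 → ∀ {g} → NonzeroApery g → ¬ Decomposable S g →
                     ∀ x → NonzeroApery x → ∃ λ k → x ≡ k * g
    apery-multiple ν≡2 {g} g-apery g-indecomposable = <-rec _ step
      where
      step : ∀ x → (∀ {y} → y < x → NonzeroApery y → ∃ λ k → y ≡ k * g) →
             NonzeroApery x → ∃ λ k → x ≡ k * g
      step x below x-apery with decomposable? x
      ... | no ¬dec = 1 , trans (indecomposables-equal ν≡2 x-apery ¬dec g-apery g-indecomposable) (sym (*-identityˡ g))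
      ... | yes dec with apery-split (proj₁ x-apery) dec
      ...   | split a b a-apery b-apery refl =
        let i , a≡ig = below (m<m+n a (n≢0⇒n>0 (proj₂ b-apery))) a-apery
            j , b≡jg = below (m<n+m b (n≢0⇒n>0 (proj₂ a-apery))) b-apery
        in i + j , trans (cong₂ _+_ a≡ig b≡jg) (sym (*-distribʳ-+ g i j))

    -- The four nonzero Apéry elements are distinct multiples of g, so one of them is at least 4g.
    four-multiple-apery : ν ≡ 2 → m′ ≡ 4 → ∀ {g} → NonzeroApery g → ¬ Decomposable S g → IsApery (4 * g)
    four-multiple-apery ν≡2 m′≡4 {g} g-apery@((g∈S , _) , g≢0) g-indecomposable =
      from-search (any? (λ w → 4 * g ≤? w) nonzeroAperyElements)
      where
      multiple = apery-multiple ν≡2 g-apery g-indecomposable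

      small-multiple : ∀ k → k * g ≢ 0 → k < 4 → k * g ∈ 1 * g ∷ 2 * g ∷ 3 * g ∷ []
      small-multiple 0 0≢0 _ = ⊥-elim (0≢0 refl)
      small-multiple 1 _ _ = here refl
      small-multiple 2 _ _ = there (here refl)
      small-multiple 3 _ _ = there (there (here refl))
      small-multiple (suc (suc (suc (suc _)))) _ (s≤s (s≤s (s≤s (s≤s ()))))

      from-search : Dec (Any (4 * g ≤_) nonzeroAperyElements) → IsApery (4 * g)
      from-search (yes some) =
        let w , w∈ , 4g≤w = find some
            k , w≡kg = multiple w (nonzeroAperyElements-apery w∈)
            4≤k = *-cancelʳ-≤ 4 k g {{≢-nonZero g≢0}} (subst (4 * g ≤_) w≡kg 4g≤w)
        in apery-summand (proj₁ (nonzeroAperyElements-apery w∈)) (multiple-∈S g∈S 4) (multiple-∈S g∈S (k ∸ 4))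
             (trans (sym (*-distribʳ-+ g 4 (k ∸ 4))) (trans (cong (_* g) (m+[n∸m]≡n 4≤k)) (sym w≡kg)))
      from-search (no none) = ⊥-elim (<-irrefl refl (subst (_≤ 3) (trans length-nonzeroAperyElements m′≡4)
        (unique-⊆⇒length≤ nonzeroAperyElements-unique below-four)))
        where
        below-four : ∀ {w} → w ∈ nonzeroAperyElements → w ∈ 1 * g ∷ 2 * g ∷ 3 * g ∷ []
        below-four {w} w∈ with multiple w (nonzeroAperyElements-apery w∈)
        ... | k , refl = small-multiple k (proj₂ (nonzeroAperyElements-apery w∈))
                           (*-cancelʳ-< g k 4 (≰⇒> (All.lookup (¬Any⇒All¬ _ none) w∈)))

  module Frobenius (f : ℕ) (frobenius : IsFrobenius S f) where

    W : ℕ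
    W = f + m

    apery-≤W : ∀ {x} → IsApery x → x ≤ W
    apery-≤W {x} (_ , x-apery) = ≮⇒≥ λ W<x →
      let m≤x = ≤-trans (m≤n+m m f) (<⇒≤ W<x)
          f<x∸m = +-cancelʳ-< m f (x ∸ m) (subst (W <_) (sym (m∸n+n≡m m≤x)) W<x)
      in x-apery (x ∸ m) (proj₂ frobenius _ f<x∸m) (m∸n+n≡m m≤x)

    quotW remW : ℕ → ℕ
    quotW u = (W ∸ u) / m
    remW  u = (W ∸ u) % m

    W∸-divMod : ∀ u → W ∸ u ≡ quotW u * m + remW u
    W∸-divMod u = trans (m≡m%n+[m/n]*n (W ∸ u) m) (+-comm (remW u) _)

    W-divMod : ∀ {u} → u ≤ W → u + quotW u * m + remW u ≡ W
    W-divMod {u} u≤W = trans (+-assoc u _ _) (trans (cong (u +_) (sym (W∸-divMod u))) (m+[n∸m]≡n u≤W))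

    remW-injective : ∀ {u v} → IsApery u → IsApery v → remW u ≡ remW v → u ≡ v
    remW-injective {u} {v} u-apery v-apery r≡r =
      apery-cancel {i = quotW u} {quotW v} u-apery v-apery (+-cancelʳ-≡ (remW u) _ _ (begin
        u + quotW u * m + remW u   ≡⟨ W-divMod (apery-≤W u-apery) ⟩
        W                          ≡⟨ W-divMod (apery-≤W v-apery) ⟨
        v + quotW v * m + remW v   ≡⟨ cong (v + quotW v * m +_) r≡r ⟨
        v + quotW v * m + remW u   ∎))
      where open ≡-Reasoning

    quotW-positive : ∀ {u} → u + m ≤ W → 1 ≤ quotW u
    quotW-positive {u} u+m≤W = m≥n⇒m/n>0 (subst (_≤ W ∸ u) (m+n∸m≡n u m) (∸-monoˡ-≤ u u+m≤W))

    pair-quotient : ∀ {u v} → u + v ≤ W →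
                    quotW 0 * m + remW 0 ≤ (quotW u + quotW v) * m + (remW u + remW v)
    pair-quotient {u} {v} u+v≤W = begin
      quotW 0 * m + remW 0                          ≡⟨ W∸-divMod 0 ⟨
      W                                             ≡⟨ m∸n+n≡m u≤W ⟨
      (W ∸ u) + u                                   ≤⟨ +-monoʳ-≤ (W ∸ u) u≤W∸v ⟩
      (W ∸ u) + (W ∸ v)                             ≡⟨ cong₂ _+_ (W∸-divMod u) (W∸-divMod v) ⟩
      (quotW u * m + remW u) + (quotW v * m + remW v) ≡⟨ regroup (quotW u) (remW u) (quotW v) (remW v) m ⟩
      (quotW u + quotW v) * m + (remW u + remW v)   ∎
      where
      open ≤-Reasoning
      u≤W : u ≤ W
      u≤W = ≤-trans (m≤m+n u v) u+v≤W
      u≤W∸v : u ≤ W ∸ v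
      u≤W∸v = subst (_≤ W ∸ v) (m+n∸n≡m u v) (∸-monoˡ-≤ v u+v≤W)
      regroup : ∀ a b c d n → (a * n + b) + (c * n + d) ≡ (a + c) * n + (b + d)
      regroup a b c d n = solve (a ∷ b ∷ c ∷ d ∷ n ∷ [])

    block : ℕ → List ℕ
    block u = map (λ j → u + j * m) (upTo (quotW u))

    blocks : List ℕ → List ℕ
    blocks []       = []
    blocks (u ∷ us) = block u ++ blocks us

    ∈-block⁻ : ∀ {u x} → x ∈ block u → ∃ λ j → j < quotW u × x ≡ u + j * m
    ∈-block⁻ x∈ with ∈-map⁻ _ x∈
    ... | j , j∈ , x≡ = j , ∈-upTo⁻ j∈ , x≡

    ∈-blocks⁻ : ∀ us {x} → x ∈ blocks us → ∃ λ u → u ∈ us × x ∈ block u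
    ∈-blocks⁻ (u ∷ us) x∈ with ∈-++⁻ (block u) x∈
    ... | inj₁ x∈block = u , here refl , x∈block
    ... | inj₂ x∈rest  = let v , v∈us , x∈block = ∈-blocks⁻ us x∈rest in v , there v∈us , x∈block

    block-below-f : ∀ {u x} → IsApery u → x ∈ block u → x < f × x ∈S S
    block-below-f {u} u-apery x∈ with ∈-block⁻ x∈
    ... | j , j<q , refl = ≤∧≢⇒< x≤f (λ x≡f → proj₁ frobenius (subst (_∈S S) x≡f x∈S)) , x∈S
      where
      x∈S : (u + j * m) ∈S S
      x∈S = ∈S-+ (proj₁ u-apery) (multiple-∈S (proj₁ multiplicity) j)
      x≤f : u + j * m ≤ f
      x≤f = +-cancelʳ-≤ m _ f (begin
        u + j * m + m      ≡⟨ regroup m ⟩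
        u + suc j * m      ≤⟨ +-monoʳ-≤ u (*-monoˡ-≤ m j<q) ⟩
        u + quotW u * m    ≤⟨ +-monoʳ-≤ u (m/n*n≤m (W ∸ u) m) ⟩
        u + (W ∸ u)        ≡⟨ m+[n∸m]≡n (apery-≤W u-apery) ⟩
        W                  ∎)
        where
        open ≤-Reasoning
        regroup : ∀ n → u + j * n + n ≡ u + suc j * n
        regroup n = solve (u ∷ j ∷ n ∷ [])

    length-blocks : ∀ us → length (blocks us) ≡ sum (map quotW us)
    length-blocks []       = refl
    length-blocks (u ∷ us) = begin
      length (block u ++ blocks us)            ≡⟨ length-++ (block u) ⟩
      length (block u) + length (blocks us)    ≡⟨ cong₂ _+_ length-block (length-blocks us) ⟩
      quotW u + sum (map quotW us)             ∎
      where
      open ≡-Reasoning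
      length-block : length (block u) ≡ quotW u
      length-block = trans (length-map (λ j → u + j * m) (upTo (quotW u))) (length-upTo (quotW u))

    blocks-unique : ∀ {us} → All IsApery us → Unique us → Unique (blocks us)
    blocks-unique {[]}     _                        _                  = []
    blocks-unique {u ∷ us} (u-apery All.∷ us-apery) (u∉us ∷ us-unique) =
      ++⁺ (map⁺ shift-injective (upTo⁺ _)) (blocks-unique us-apery us-unique) disjoint
      where
      shift-injective : ∀ {j j′} → u + j * m ≡ u + j′ * m → j ≡ j′
      shift-injective eq = *-cancelʳ-≡ _ _ m (+-cancelˡ-≡ u _ _ eq)

      disjoint : ∀ {x} → ¬ (x ∈ block u × x ∈ blocks us)
      disjoint (x∈block , x∈rest) with ∈-blocks⁻ us x∈rest
      ... | v , v∈us , x∈block′ with ∈-block⁻ x∈block | ∈-block⁻ x∈block′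
      ...   | j , _ , x≡ | j′ , _ , x≡′ =
        All.lookup u∉us v∈us (apery-cancel {i = j} {j′} u-apery (All.lookup us-apery v∈us) (trans (sym x≡) x≡′))

    apery-count : ∀ {us} → All IsApery us → Unique us → sum (map quotW us) ≤ countBelow S f
    apery-count {us} us-apery us-unique = subst (_≤ countBelow S f) (length-blocks us)
      (unique-below⇒≤countBelow S (blocks-unique us-apery us-unique) λ x∈ →
        let u , u∈us , x∈block = ∈-blocks⁻ us x∈ in block-below-f (All.lookup us-apery u∈us) x∈block)

    slack : ℕ
    slack = m ∸ suc (remW 0)

    record Witness (ν d : ℕ) : Set where
      constructor witness
      field
        elements      : List ℕ
        nonzero-apery : All NonzeroApery elements
        unique        : Unique elements
        bound         : d * quotW 0 ≤ ν * sum (map quotW elements) + slack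

    witness⇒wilf : ∀ {ν d} → m ≤ ν + d → Witness ν d → f + 1 ≤ ν * countBelow S f
    witness⇒wilf {ν} {d} m≤ν+d (witness us us-apery us-unique bound) = begin
      f + 1                                ≤⟨ wilf-arithmetic {ν = ν} {d} {quotW 0} {N = sum (map quotW us)}
                                                (m%n<n W m) (W∸-divMod 0) m≤ν+d bound ⟩
      ν * (quotW 0 + sum (map quotW us))   ≤⟨ *-monoʳ-≤ ν (apery-count (zero-apery All.∷ All.map proj₁ us-apery)
                                                                   (All.map (≢-sym ∘ proj₂) us-apery ∷ us-unique)) ⟩
      ν * countBelow S f                   ∎
      where open ≤-Reasoning

    double-fitting : ∀ {x} → IsApery x → Split x → ∃ λ u → NonzeroApery u × u + u ≤ W
    double-fitting x-apery (split a b a-apery b-apery refl) with ≤-total a b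
    ... | inj₁ a≤b = a , a-apery , ≤-trans (+-monoʳ-≤ a a≤b) (apery-≤W x-apery)
    ... | inj₂ b≤a = b , b-apery , ≤-trans (+-monoˡ-≤ b b≤a) (apery-≤W x-apery)

    record FittingPair : Set where
      constructor fitting-pair
      field
        u v     : ℕ
        u-apery : NonzeroApery u
        v-apery : NonzeroApery v
        u≢v     : u ≢ v
        u+v≤W   : u + v ≤ W

    fitting-pair-of : ∀ {x y} → IsApery x → Split x → IsApery y → Split y → x ≢ y → FittingPair
    fitting-pair-of x-apery (split a b a-apery b-apery refl) y-apery (split c d c-apery d-apery refl) x≢y
      with a ≟ b | c ≟ d
    ... | no a≢b   | _        = fitting-pair a b a-apery b-apery a≢b (apery-≤W x-apery)
    ... | yes _    | no c≢d   = fitting-pair c d c-apery d-apery c≢d (apery-≤W y-apery)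
    ... | yes refl | yes refl = fitting-pair a c a-apery c-apery (λ { refl → x≢y refl })
                                  (doubles⇒sum-≤ {a} {c} (apery-≤W x-apery) (apery-≤W y-apery))

    record DoubledPair : Set where
      constructor doubled-pair
      field
        u v     : ℕ
        u-apery : NonzeroApery u
        v-apery : NonzeroApery v
        u≢v     : u ≢ v
        u+u≤W   : u + u ≤ W
        v+v≤W   : v + v ≤ W

    record FittingTriple : Set where
      constructor fitting-triple
      field
        u v w   : ℕ
        u-apery : NonzeroApery u
        v-apery : NonzeroApery v
        w-apery : NonzeroApery w
        u≢v     : u ≢ v
        u≢w     : u ≢ w
        v≢w     : v ≢ w
        u+v≤W   : u + v ≤ W
        w+m≤W   : w + m ≤ W

    private
      summand+m≤W : ∀ {y a b} → IsApery y → NonzeroApery b → a + b ≡ y → a + m ≤ W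
      summand+m≤W y-apery ((b∈S , _) , b≢0) refl =
        ≤-trans (+-monoʳ-≤ _ (multiplicity-≤ b∈S b≢0)) (apery-≤W y-apery)

      in-pair? : ∀ a b t → (t ≡ a ⊎ t ≡ b) ⊎ (t ≢ a × t ≢ b)
      in-pair? a b t with t ≟ a | t ≟ b
      ... | yes t≡a | _       = inj₁ (inj₁ t≡a)
      ... | no _    | yes t≡b = inj₁ (inj₂ t≡b)
      ... | no t≢a  | no t≢b  = inj₂ (t≢a , t≢b)

      in-pair⇒double : ∀ {a b c d} → c ≡ a ⊎ c ≡ b → d ≡ a ⊎ d ≡ b → c + d ≢ a + b → c ≡ d
      in-pair⇒double (inj₁ refl) (inj₁ refl) _ = refl
      in-pair⇒double (inj₂ refl) (inj₂ refl) _ = refl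
      in-pair⇒double (inj₁ refl) (inj₂ refl) c+d≢a+b = ⊥-elim (c+d≢a+b refl)
      in-pair⇒double {a} {b} (inj₂ refl) (inj₁ refl) c+d≢a+b = ⊥-elim (c+d≢a+b (+-comm b a))

      -- A summand of y or z outside {a, b} completes a triple; otherwise y and z, being different
      -- from a + b, are doubles.
      beside-nondouble : ∀ {a b y z} → NonzeroApery a → NonzeroApery b → a ≢ b → a + b ≤ W →
        IsApery y → Split y → IsApery z → Split z → y ≢ a + b → z ≢ a + b → y ≢ z →
        DoubledPair ⊎ FittingTriple
      beside-nondouble {a} {b} a-apery b-apery a≢b a+b≤W
        y-apery (split c d c-apery d-apery refl) z-apery (split e g e-apery g-apery refl) y≢ z≢ y≢z
        with in-pair? a b c | in-pair? a b d | in-pair? a b e | in-pair? a b g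
      ... | inj₂ (c≢a , c≢b) | _ | _ | _ = inj₂ (fitting-triple a b c a-apery b-apery c-apery
              a≢b (≢-sym c≢a) (≢-sym c≢b) a+b≤W (summand+m≤W y-apery d-apery refl))
      ... | inj₁ _ | inj₂ (d≢a , d≢b) | _ | _ = inj₂ (fitting-triple a b d a-apery b-apery d-apery
              a≢b (≢-sym d≢a) (≢-sym d≢b) a+b≤W (summand+m≤W y-apery c-apery (+-comm d c)))
      ... | inj₁ _ | inj₁ _ | inj₂ (e≢a , e≢b) | _ = inj₂ (fitting-triple a b e a-apery b-apery e-apery
              a≢b (≢-sym e≢a) (≢-sym e≢b) a+b≤W (summand+m≤W z-apery g-apery refl))
      ... | inj₁ _ | inj₁ _ | inj₁ _ | inj₂ (g≢a , g≢b) = inj₂ (fitting-triple a b g a-apery b-apery g-apery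
              a≢b (≢-sym g≢a) (≢-sym g≢b) a+b≤W (summand+m≤W z-apery e-apery (+-comm g e)))
      ... | inj₁ c∈ | inj₁ d∈ | inj₁ e∈ | inj₁ g∈ with in-pair⇒double c∈ d∈ y≢ | in-pair⇒double e∈ g∈ z≢
      ...   | refl | refl = inj₁ (doubled-pair c e c-apery e-apery (λ { refl → y≢z refl })
                                   (apery-≤W y-apery) (apery-≤W z-apery))

    doubled-pair-or-triple : ∀ {x y z} → IsApery x → Split x → IsApery y → Split y → IsApery z → Split z →
                             x ≢ y → x ≢ z → y ≢ z → DoubledPair ⊎ FittingTriple
    doubled-pair-or-triple x-apery sx@(split a b a-apery b-apery refl) y-apery sy@(split c d c-apery d-apery refl)
                           z-apery sz@(split e g e-apery g-apery refl) x≢y x≢z y≢z with a ≟ b | c ≟ d | e ≟ g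
    ... | no a≢b | _ | _ =
      beside-nondouble a-apery b-apery a≢b (apery-≤W x-apery) y-apery sy z-apery sz (≢-sym x≢y) (≢-sym x≢z) y≢z
    ... | yes _ | no c≢d | _ =
      beside-nondouble c-apery d-apery c≢d (apery-≤W y-apery) x-apery sx z-apery sz x≢y (≢-sym y≢z) x≢z
    ... | yes _ | yes _ | no e≢g =
      beside-nondouble e-apery g-apery e≢g (apery-≤W z-apery) x-apery sx y-apery sy x≢z y≢z x≢y
    ... | yes refl | yes refl | yes _ =
      inj₁ (doubled-pair a c a-apery c-apery (λ { refl → x≢y refl }) (apery-≤W x-apery) (apery-≤W y-apery))

    remW<m : ∀ u → remW u < m
    remW<m u = m%n<n (W ∸ u) m

    remW-distinct : ∀ {u v} → NonzeroApery u → NonzeroApery v → u ≢ v → remW u ≢ remW v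
    remW-distinct u-apery v-apery u≢v = u≢v ∘ remW-injective (proj₁ u-apery) (proj₁ v-apery)

    scale-≤ : ∀ {c ν} N → c ≤ ν → c * N + slack ≤ ν * N + slack
    scale-≤ N c≤ν = +-monoˡ-≤ slack (*-monoˡ-≤ N c≤ν)


    witness₁ : ∀ {ν} → 2 ≤ ν → (∃ λ u → NonzeroApery u × u + u ≤ W) → Witness ν 1
    witness₁ {ν} 2≤ν (u , u-apery , u+u≤W) = witness (u ∷ []) (u-apery All.∷ All.[]) (All.[] ∷ []) (begin
      1 * quotW 0                  ≤⟨ scaled-quotient-bound {m} {quotW 0} {q + q} {remW 0} 1
                                        (1+sum<double (remW<m u) (remW<m u)) (pair-quotient {u} {u} u+u≤W) ⟩
      1 * (q + q) + slack              ≡⟨ cong (_+ slack) (double q) ⟩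
      2 * (q + 0) + slack              ≤⟨ scale-≤ (q + 0) 2≤ν ⟩
      ν * (q + 0) + slack              ∎)
      where
      open ≤-Reasoning
      q = quotW u
      double : ∀ n → 1 * (n + n) ≡ 2 * (n + 0)
      double n = solve (n ∷ [])

    witness₂ : ∀ {ν} → 2 ≤ ν → FittingPair → Witness ν 2
    witness₂ {ν} 2≤ν (fitting-pair u v u-apery v-apery u≢v u+v≤W) =
      witness (u ∷ v ∷ []) (u-apery All.∷ v-apery All.∷ All.[]) ((u≢v All.∷ All.[]) ∷ All.[] ∷ []) (begin
        2 * quotW 0                ≤⟨ scaled-quotient-bound {m} {quotW 0} {qu + qv} {remW 0} 2
                                        (2+sum<double (remW<m u) (remW<m v) (remW-distinct u-apery v-apery u≢v))
                                        (pair-quotient {u} {v} u+v≤W) ⟩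
        2 * (qu + qv) + slack          ≡⟨ cong (λ n → 2 * (qu + n) + slack) (+-identityʳ qv) ⟨
        2 * (qu + (qv + 0)) + slack    ≤⟨ scale-≤ (qu + (qv + 0)) 2≤ν ⟩
        ν * (qu + (qv + 0)) + slack    ∎)
      where
      open ≤-Reasoning
      qu = quotW u
      qv = quotW v

    witness₃-pair : ∀ {ν} → 3 ≤ ν → DoubledPair → Witness ν 3
    witness₃-pair {ν} 3≤ν (doubled-pair u v u-apery v-apery u≢v u+u≤W v+v≤W) =
      witness (u ∷ v ∷ []) (u-apery All.∷ v-apery All.∷ All.[]) ((u≢v All.∷ All.[]) ∷ All.[] ∷ []) (begin
        3 * quotW 0                ≤⟨ double-pair-bound {m} {quotW 0} {remW 0} {qu} {qv}
                                        (remW<m u) (remW<m v) (remW-distinct u-apery v-apery u≢v)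
                                        (pair-quotient {u} {u} u+u≤W) (pair-quotient {v} {v} v+v≤W)
                                        (pair-quotient {u} {v} (doubles⇒sum-≤ {u} {v} u+u≤W v+v≤W)) ⟩
        3 * (qu + qv) + slack          ≡⟨ cong (λ n → 3 * (qu + n) + slack) (+-identityʳ qv) ⟨
        3 * (qu + (qv + 0)) + slack    ≤⟨ scale-≤ (qu + (qv + 0)) 3≤ν ⟩
        ν * (qu + (qv + 0)) + slack    ∎)
      where
      open ≤-Reasoning
      qu = quotW u
      qv = quotW v

    witness₃-triple : ∀ {ν} → 3 ≤ ν → FittingTriple → Witness ν 3
    witness₃-triple {ν} 3≤ν (fitting-triple u v w u-apery v-apery w-apery u≢v u≢w v≢w u+v≤W w+m≤W) =
      witness (u ∷ v ∷ w ∷ []) (u-apery All.∷ v-apery All.∷ w-apery All.∷ All.[])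
        ((u≢v All.∷ u≢w All.∷ All.[]) ∷ (v≢w All.∷ All.[]) ∷ All.[] ∷ []) (begin
        3 * quotW 0                      ≤⟨ *-monoʳ-≤ 3 (star-bound {m} {quotW 0} {qu + qv} {remW 0}
                                              (+-mono-< (remW<m u) (remW<m v))
                                              (pair-quotient {u} {v} u+v≤W) (quotW-positive w+m≤W)) ⟩
        3 * (qu + qv + qw)               ≤⟨ m≤m+n _ slack ⟩
        3 * (qu + qv + qw) + slack           ≡⟨ cong (λ n → 3 * n + slack) (sum-three qu qv qw) ⟨
        3 * (qu + (qv + (qw + 0))) + slack   ≤⟨ scale-≤ (qu + (qv + (qw + 0))) 3≤ν ⟩
        ν * (qu + (qv + (qw + 0))) + slack   ∎)
      where
      open ≤-Reasoning
      qu = quotW u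
      qv = quotW v
      qw = quotW w

  module Wilf (f : ℕ) (frobenius : IsFrobenius S f) (ν : ℕ) (embedding : IsEmbeddingDimension S ν) where
    open Frobenius f frobenius
    open Generators ν embedding

    five-witness : ν ≡ 2 → m′ ≡ 4 → Witness ν 3
    five-witness ν≡2 m′≡4 = witness (g₁ ∷ g₂ ∷ g₃ ∷ [])
      (g₁-apery All.∷ g₂-apery All.∷ g₃-apery All.∷ All.[])
      ((g₁≢g₂ All.∷ g₁≢g₃ All.∷ All.[]) ∷ (g₂≢g₃ All.∷ All.[]) ∷ All.[] ∷ [])
      (begin
        3 * quotW 0                         ≤⟨ five-bound {m} {quotW 0} {remW 0} {q₁} {q₂} {q₃} (cong suc m′≡4)
                                                 (remW<m g₁) (remW<m g₂) (remW<m g₃)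
                                                 (remW-distinct g₁-apery g₂-apery g₁≢g₂)
                                                 (remW-distinct g₁-apery g₃-apery g₁≢g₃)
                                                 (remW-distinct g₂-apery g₃-apery g₂≢g₃)
                                                 (pair-quotient {g₂} {g₂} (subst (_≤ W) (sym (sum≡4g 2 2 refl)) 4g≤W))
                                                 (pair-quotient {g₁} {g₃} (subst (_≤ W) (sym (sum≡4g 1 3 refl)) 4g≤W)) ⟩
        2 * (q₁ + q₂ + q₃) + slack              ≡⟨ cong₂ (λ c n → c * n + slack) ν≡2 (sum-three q₁ q₂ q₃) ⟨
        ν * sum (q₁ ∷ q₂ ∷ q₃ ∷ []) + slack     ∎)
      where
      open ≤-Reasoning
      some-apery = nonempty⇒∈ (subst (1 ≤_) (sym (trans length-nonzeroAperyElements m′≡4)) (s≤s z≤n))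
      generator = ∃-indecomposable-apery _ (nonzeroAperyElements-apery (proj₂ some-apery))
      g = proj₁ generator
      g-apery = proj₁ (proj₂ generator)
      g≢0 = proj₂ g-apery
      g∈S = proj₁ (proj₁ g-apery)
      4g-apery = four-multiple-apery ν≡2 m′≡4 g-apery (proj₂ (proj₂ generator))
      4g≤W = apery-≤W 4g-apery

      sum≡4g : ∀ i j → i + j ≡ 4 → i * g + j * g ≡ 4 * g
      sum≡4g i j i+j≡4 = trans (sym (*-distribʳ-+ g i j)) (cong (_* g) i+j≡4)

      multiple≢ : ∀ i j → i ≢ j → i * g ≢ j * g
      multiple≢ i j i≢j = i≢j ∘ *-cancelʳ-≡ i j g {{≢-nonZero g≢0}}

      multiple-apery : ∀ i j → i ≢ 0 → i + j ≡ 4 → NonzeroApery (i * g)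
      multiple-apery i j i≢0 i+j≡4 =
        apery-summand 4g-apery (multiple-∈S g∈S i) (multiple-∈S g∈S j) (sum≡4g i j i+j≡4) , multiple≢ i 0 i≢0

      g₁ = 1 * g
      g₂ = 2 * g
      g₃ = 3 * g
      q₁ = quotW g₁
      q₂ = quotW g₂
      q₃ = quotW g₃
      g₁-apery = multiple-apery 1 3 (λ ()) refl
      g₂-apery = multiple-apery 2 2 (λ ()) refl
      g₃-apery = multiple-apery 3 1 (λ ()) refl
      g₁≢g₂ = multiple≢ 1 2 (λ ())
      g₁≢g₃ = multiple≢ 1 3 (λ ())
      g₂≢g₃ = multiple≢ 2 3 (λ ())

    witness-for-deficit : ∀ d → d ≤ 3 → m ∸ ν ≡ d → Witness ν d
    witness-for-deficit 0 _ _ = witness [] All.[] [] z≤n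
    witness-for-deficit 1 _ deficit with nonempty⇒∈ (subst (_≤ length decomposables) deficit many-decomposables)
    ... | x , x∈ =
      let x-apery , x-dec = ∈-decomposables⁻ x∈
      in witness₁ (2≤ν x-apery) (double-fitting (proj₁ x-apery) (apery-split (proj₁ x-apery) x-dec))
    witness-for-deficit 2 _ deficit
      with two-distinct decomposables-unique (subst (_≤ length decomposables) deficit many-decomposables)
    ... | x , y , x∈ , y∈ , x≢y =
      let x-apery , x-dec = ∈-decomposables⁻ x∈
          y-apery , y-dec = ∈-decomposables⁻ y∈
      in witness₂ (2≤ν x-apery) (fitting-pair-of (proj₁ x-apery) (apery-split (proj₁ x-apery) x-dec)
                                                 (proj₁ y-apery) (apery-split (proj₁ y-apery) y-dec) x≢y)
    witness-for-deficit 3 _ deficit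
      with three-distinct decomposables-unique (subst (_≤ length decomposables) deficit many-decomposables) | ν ≟ 2
    ... | _ | yes ν≡2 = five-witness ν≡2 (1+n∸2≡3⇒n≡4 m′ (subst (λ n → m ∸ n ≡ 3) ν≡2 deficit))
    ... | x , y , z , x∈ , y∈ , z∈ , x≢y , x≢z , y≢z | no ν≢2 =
      let x-apery , x-dec = ∈-decomposables⁻ x∈
          y-apery , y-dec = ∈-decomposables⁻ y∈
          z-apery , z-dec = ∈-decomposables⁻ z∈
          3≤ν = ≤∧≢⇒< (2≤ν x-apery) (ν≢2 ∘ sym)
      in [ witness₃-pair 3≤ν , witness₃-triple 3≤ν ]′
           (doubled-pair-or-triple (proj₁ x-apery) (apery-split (proj₁ x-apery) x-dec)
                                   (proj₁ y-apery) (apery-split (proj₁ y-apery) y-dec)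
                                   (proj₁ z-apery) (apery-split (proj₁ z-apery) z-dec) x≢y x≢z y≢z)
    witness-for-deficit (suc (suc (suc (suc _)))) (s≤s (s≤s (s≤s ()))) _

    wilf : m ∸ ν ≤ 3 → f + 1 ≤ ν * countBelow S f
    wilf deficit≤3 = witness⇒wilf (m≤n+m∸n m ν) (witness-for-deficit (m ∸ ν) deficit≤3 refl)

lemma3 : (S : NumericalSemigroup) (f m ν : ℕ) →
    IsFrobenius S f → IsMultiplicity S m → IsEmbeddingDimension S ν →
    m ∸ ν ≤ 3 →
    f + 1 ≤ ν * countBelow S f
lemma3 S f zero     ν _         (_ , 0≢0 , _) _         _         = ⊥-elim (0≢0 refl)
lemma3 S f (suc m′) ν frobenius multiplicity  embedding deficit≤3 =
  Apery.Wilf.wilf S m′ multiplicity f frobenius ν embedding deficit≤3
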